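{- Let $G$ be a finite loopless graph. Then $\mathrm{hn}_{cc}(G)=|V(G)|$ if and only if $G$ is a forest (has no cycle).
   Context: Graphs may have parallel edges; two distinct parallel edges form a cycle of length $2$. A cycle is a closed walk $(v_1,\dots,v_q,v_1)$ with at least one edge in which the only repeated vertex is $v_1$. For $S\subseteq V(G)$, $I_{cc}(S)=S\cup\{x\in V(G): \text{there is a cycle } C \text{ of } G \text{ with } V(C)\setminus S=\{x\}\}$. A set $X$ is convex if $I_{cc}(X)=X$; $\mathrm{hull}(X)$ is the smallest convex set containing $X$; $X$ is a hull set if $\mathrm{hull}(X)=V(G)$; $\mathrm{hn}_{cc}(G)$ is the minimum cardinality of a hull set. -}

module Defs where

open import Data.Nat using (ℕ; suc; _≤_)
open import Data.Fin using (Fin; zero; suc; inject₁; fromℕ)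
open import Data.Fin.Subset using (Subset; _∈_; _∉_; _⊆_; ∣_∣; ⊤)
open import Data.Product using (Σ; ∃; _×_; _,_; proj₁; proj₂)
open import Data.Sum using (_⊎_)
open import Relation.Nullary using (¬_)
open import Relation.Binary.PropositionalEquality using (_≡_; _≢_)
open import Function.Definitions using (Injective)

-- A finite multigraph: vertices Fin n, edges Fin m, each edge has two ends.
-- Parallel edges are allowed (distinct edge indices with the same ends).
record Graph : Set where
  field
    n    : ℕ
    m    : ℕ
    ends : Fin m → Fin n × Fin n

open Graph public

V : Graph → Set
V G = Fin (n G)

E : Graph → Set
E G = Fin (m G)

Loopless : Graph → Set
Loopless G = (e : E G) → proj₁ (ends G e) ≢ proj₂ (ends G e)

Joins : (G : Graph) → E G → V G → V G → Set
Joins G e x y = ends G e ≡ (x , y) ⊎ ends G e ≡ (y , x)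

-- A cycle of length L ≥ 1: closed walk  w 0, e 0, w 1, …, e (L-1), w L = w 0
-- with the vertices w 0 … w (L-1) pairwise distinct and the edges pairwise
-- distinct (so two distinct parallel edges give a cycle of length 2, but
-- traversing one edge back and forth is not a cycle).
record Cycle (G : Graph) : Set where
  field
    len     : ℕ
    walk    : Fin (suc (suc len)) → V G          -- length L = suc len
    edge    : Fin (suc len) → E G
    closed  : walk (fromℕ (suc len)) ≡ walk zero
    joins   : (i : Fin (suc len)) → Joins G (edge i) (walk (inject₁ i)) (walk (suc i))
    vinj    : Injective _≡_ _≡_ (λ (i : Fin (suc len)) → walk (inject₁ i))
    einj    : Injective _≡_ _≡_ edge

open Cycle public

OnCycle : {G : Graph} → Cycle G → V G → Set
OnCycle C x = ∃ λ i → walk C (inject₁ i) ≡ x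

InIcc : (G : Graph) → Subset (n G) → V G → Set
InIcc G S x = x ∈ S ⊎
  (Σ (Cycle G) λ C → OnCycle C x × x ∉ S × (∀ y → OnCycle C y → y ∉ S → y ≡ x))

Convex : (G : Graph) → Subset (n G) → Set
Convex G X = ∀ x → InIcc G X x → x ∈ X

-- hull(X) = V(G): every convex set containing X (hence the smallest one) is V(G)
IsHullSet : (G : Graph) → Subset (n G) → Set
IsHullSet G X = ∀ Y → X ⊆ Y → Convex G Y → ∀ x → x ∈ Y

IsHullNumber : (G : Graph) → ℕ → Set
IsHullNumber G h = (Σ (Subset (n G)) λ X → IsHullSet G X × ∣ X ∣ ≡ h)
                 × (∀ X → IsHullSet G X → h ≤ ∣ X ∣)

IsForest : Graph → Set
IsForest G = ¬ Cycle G

module Submission where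

-- In a forest I_cc is the identity, so every set is convex and the only hull set is V(G).
-- If x lies on a cycle C, then V(C) ∖ (V(G) − x) = {x}, so x ∈ I_cc(V(G) − x) and V(G) − x
-- is already a hull set.

open import Defs
open import Data.Nat using (_≤_; _<_)
open import Data.Nat.Properties using (<-irrefl; module ≤-Reasoning)
open import Data.Fin using (Fin; zero; inject₁; _≟_)
open import Data.Fin.Subset using (Subset; ⊤; ∁; ⁅_⁆; _∈_; _∉_; _⊆_; ∣_∣)
open import Data.Fin.Subset.Properties
  using (_∈?_; ∈⊤; ∣⊤∣≡n; p⊆q⇒∣p∣≤∣q∣; p⊂q⇒∣p∣<∣q∣; x∈⁅x⁆; x≢y⇒x∉⁅y⁆; x∈p⇒x∉∁p; x∉p⇒x∈∁p)
open import Data.Product using (_,_)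
open import Data.Sum using (inj₁; inj₂)
open import Data.Empty using (⊥-elim)
open import Function using (id; _∘_)
open import Function.Bundles using (_⇔_; mk⇔)
open import Relation.Binary.PropositionalEquality using (_≡_; _≢_; refl; subst)
open import Relation.Nullary using (yes; no)
open import Relation.Nullary.Decidable using (decidable-stable)

x∉p⇒∣p∣<n : ∀ {k} {x : Fin k} {p : Subset k} → x ∉ p → ∣ p ∣ < k
x∉p⇒∣p∣<n {k} {x} {p} x∉p =
  subst (∣ p ∣ <_) (∣⊤∣≡n k) (p⊂q⇒∣p∣<∣q∣ ((λ _ → ∈⊤) , x , ∈⊤ , x∉p))

∁⁅x⁆-isNotFull : ∀ {k} (x : Fin k) → ∣ ∁ ⁅ x ⁆ ∣ < k
∁⁅x⁆-isNotFull x = x∉p⇒∣p∣<n (x∈p⇒x∉∁p (x∈⁅x⁆ x))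

module _ {G : Graph} where

  ⊤-isHullSet : IsHullSet G ⊤
  ⊤-isHullSet Y ⊤⊆Y _ x = ⊤⊆Y ∈⊤

  forest⇒convex : IsForest G → ∀ X → Convex G X
  forest⇒convex _      X x (inj₁ x∈X)     = x∈X
  forest⇒convex forest X x (inj₂ (C , _)) = ⊥-elim (forest C)

  forest⇒⊤⊆hullSet : IsForest G → ∀ {X} → IsHullSet G X → ⊤ ⊆ X
  forest⇒⊤⊆hullSet forest {X} hull {x} _ = hull X id (forest⇒convex forest X) x

  forest⇒hullNumber≡n : IsForest G → IsHullNumber G (n G)
  forest⇒hullNumber≡n forest =
    (⊤ , ⊤-isHullSet , ∣⊤∣≡n (n G)) ,
    λ X hull → subst (_≤ ∣ X ∣) (∣⊤∣≡n (n G))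
                 (p⊆q⇒∣p∣≤∣q∣ (forest⇒⊤⊆hullSet forest hull))

  convex-∋-cycleVertex : (C : Cycle G) → ∀ {x Y} → OnCycle C x → Convex G Y →
                         (∀ y → y ≢ x → y ∈ Y) → x ∈ Y
  convex-∋-cycleVertex C {x} {Y} x∈C convex others =
    decidable-stable (x ∈? Y) λ x∉Y →
      x∉Y (convex x (inj₂ (C , x∈C , x∉Y , onlyOutside)))
    where
    onlyOutside : ∀ y → OnCycle C y → y ∉ Y → y ≡ x
    onlyOutside y _ y∉Y = decidable-stable (y ≟ x) (y∉Y ∘ others y)

  ∁⁅cycleVertex⁆-isHullSet : (C : Cycle G) → ∀ {x} → OnCycle C x → IsHullSet G (∁ ⁅ x ⁆)
  ∁⁅cycleVertex⁆-isHullSet C {x} x∈C Y ∁⁅x⁆⊆Y convex = inY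
    where
    others : ∀ y → y ≢ x → y ∈ Y
    others y y≢x = ∁⁅x⁆⊆Y (x∉p⇒x∈∁p (x≢y⇒x∉⁅y⁆ y≢x))

    inY : ∀ z → z ∈ Y
    inY z with z ≟ x
    ... | yes refl = convex-∋-cycleVertex C x∈C convex others
    ... | no z≢x   = others z z≢x

  cycle⇒hullNumber<n : Cycle G → ∀ {h} → IsHullNumber G h → h < n G
  cycle⇒hullNumber<n C {h} (_ , minimal) = begin-strict
    h              ≤⟨ minimal (∁ ⁅ x ⁆) (∁⁅cycleVertex⁆-isHullSet C (zero , refl)) ⟩
    ∣ ∁ ⁅ x ⁆ ∣    <⟨ ∁⁅x⁆-isNotFull x ⟩
    n G            ∎
    where
    open ≤-Reasoning
    x : V G
    x = walk C (inject₁ zero)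

corollary2 : (G : Graph) → Loopless G → (IsHullNumber G (n G) ⇔ IsForest G)
corollary2 G _ = mk⇔
  (λ hullNumber≡n C → <-irrefl refl (cycle⇒hullNumber<n C hullNumber≡n))
  forest⇒hullNumber≡n
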